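{- In any modal FL-algebra $(L,\sqsubseteq,\otimes,1,\Rightarrow_l,\Rightarrow_r,0,!,?)$, the operation $?$ is monotone (i.e. $a\sqsubseteq b$ implies $?a\sqsubseteq ?b$) and satisfies, for all $a,b$, (c6) $!a\otimes ?b\sqsubseteq ?(a\otimes b)$ and (c7) $?a\otimes !b\sqsubseteq ?(a\otimes b)$.
   Context: A residuated lattice is a structure $(L,\sqsubseteq,\otimes,1,\Rightarrow_l,\Rightarrow_r)$ where $(L,\sqsubseteq)$ is a lattice (join $\sqcup$, meet $\sqcap$), $(L,\otimes,1)$ is a monoid with $\otimes$ monotone in each argument, and $a\sqsubseteq b\Rightarrow_l c$ iff $a\otimes b\sqsubseteq c$ iff $b\sqsubseteq a\Rightarrow_r c$. An FL-algebra is a residuated lattice with an additional distinguished element $0$; it is bounded if it has a least element $\bot$ and greatest element $\top$. A storage modality is a unary operation $!$ with: (s1) $!a\sqsubseteq a$; (s2) $!a\sqsubseteq !!a$; (s3) $!1=1$; (s4) $!(a\sqcap b)=!a\otimes !b$; (s5) $!a\otimes b=b\otimes !a$. A modal FL-algebra is a bounded FL-algebra with a storage modality $!$ and a unary operation $?$ satisfying for all $a,b$: (c1) $!(a\Rightarrow_i b)\sqsubseteq ?a\Rightarrow_i ?b$ for $i=l,r$; (c2) $a\sqsubseteq ?a$; (c3) $??a\sqsubseteq ?a$; (c4) $?0\sqsubseteq 0$; (c5) $0\sqsubseteq ?a$. -}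

module Defs where

open import Level using (Level; suc; _⊔_)
open import Relation.Binary.PropositionalEquality using (_≡_)
open import Data.Product using (_×_)
open import Function.Bundles using (_⇔_)

-- Equality on the carrier is
-- propositional equality; the lattice is given as a partial order
-- (L, ⊑) with binary joins ⊔ and meets ⊓ (least upper / greatest lower
-- bounds), which is the order-theoretic definition of a lattice.
record ModalFLAlgebra (c ℓ : Level) : Set (suc (c ⊔ ℓ)) where
  infix  4 _⊑_
  infixr 6 _⊔'_
  infixr 7 _⊓_
  infixl 8 _⊗_
  field
    L      : Set c
    _⊑_    : L → L → Set ℓ
    ⊑-refl    : ∀ {a} → a ⊑ a
    ⊑-trans   : ∀ {a b c} → a ⊑ b → b ⊑ c → a ⊑ c
    ⊑-antisym : ∀ {a b} → a ⊑ b → b ⊑ a → a ≡ b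
    _⊔'_   : L → L → L
    _⊓_    : L → L → L
    ⊔-upperˡ : ∀ a b → a ⊑ a ⊔' b
    ⊔-upperʳ : ∀ a b → b ⊑ a ⊔' b
    ⊔-least  : ∀ {a b c} → a ⊑ c → b ⊑ c → a ⊔' b ⊑ c
    ⊓-lowerˡ : ∀ a b → a ⊓ b ⊑ a
    ⊓-lowerʳ : ∀ a b → a ⊓ b ⊑ b
    ⊓-greatest : ∀ {a b c} → c ⊑ a → c ⊑ b → c ⊑ a ⊓ b
    _⊗_    : L → L → L
    𝟙      : L
    ⊗-assoc  : ∀ a b c → (a ⊗ b) ⊗ c ≡ a ⊗ (b ⊗ c)
    ⊗-identityˡ : ∀ a → 𝟙 ⊗ a ≡ a
    ⊗-identityʳ : ∀ a → a ⊗ 𝟙 ≡ a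
    ⊗-mono   : ∀ {a a' b b'} → a ⊑ a' → b ⊑ b' → a ⊗ b ⊑ a' ⊗ b'
    _⇒ₗ_ _⇒ᵣ_ : L → L → L
    resₗ : ∀ {a b c} → (a ⊑ b ⇒ₗ c) ⇔ (a ⊗ b ⊑ c)
    resᵣ : ∀ {a b c} → (b ⊑ a ⇒ᵣ c) ⇔ (a ⊗ b ⊑ c)
    𝟘 : L
    ⊥' ⊤' : L
    ⊥-least    : ∀ a → ⊥' ⊑ a
    ⊤-greatest : ∀ a → a ⊑ ⊤'
    ! : L → L
    s1 : ∀ a → ! a ⊑ a
    s2 : ∀ a → ! a ⊑ ! (! a)
    s3 : ! 𝟙 ≡ 𝟙
    s4 : ∀ a b → ! (a ⊓ b) ≡ ! a ⊗ ! b
    s5 : ∀ a b → ! a ⊗ b ≡ b ⊗ ! a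
    ¿ : L → L
    c1ₗ : ∀ a b → ! (a ⇒ₗ b) ⊑ ¿ a ⇒ₗ ¿ b
    c1ᵣ : ∀ a b → ! (a ⇒ᵣ b) ⊑ ¿ a ⇒ᵣ ¿ b
    c2 : ∀ a → a ⊑ ¿ a
    c3 : ∀ a → ¿ (¿ a) ⊑ ¿ a
    c4 : ¿ 𝟘 ⊑ 𝟘
    c5 : ∀ a → 𝟘 ⊑ ¿ a

-- Every ingredient comes from (c1) applied to a residual of the form x ⇒ y
-- lying above something we control.  Monotonicity of ! follows from (s3)/(s4),
-- which force ! a ⊑ 𝟙 and hence ! a = ! (a ⊓ b) = ! a ⊗ ! b ⊑ ! b when a ⊑ b.
-- Then a ⊑ b gives 𝟙 = ! 𝟙 ⊑ ! (a ⇒ₗ b) ⊑ ¿ a ⇒ₗ ¿ b, i.e. ¿ a ⊑ ¿ b;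
-- and a ⊑ b ⇒ₗ (a ⊗ b) gives ! a ⊑ ¿ b ⇒ₗ ¿ (a ⊗ b), which is (c6).
-- (c7) is the mirror image, using ⇒ᵣ.
module Submission where

open import Defs
open import Level using (Level)
open import Data.Product using (_×_; _,_)
open import Function.Bundles using (Equivalence)
open import Relation.Binary.PropositionalEquality using (_≡_; refl; sym; trans; cong; module ≡-Reasoning)

module ModalFLAlgebraProperties {c ℓ : Level} (M : ModalFLAlgebra c ℓ) where

  open ModalFLAlgebra M

  ≡⇒⊑ : ∀ {a b} → a ≡ b → a ⊑ b
  ≡⇒⊑ refl = ⊑-refl

  ⊑⇒𝟙⊑⇒ₗ : ∀ {a b} → a ⊑ b → 𝟙 ⊑ a ⇒ₗ b
  ⊑⇒𝟙⊑⇒ₗ {a} p = Equivalence.from resₗ (⊑-trans (≡⇒⊑ (⊗-identityˡ a)) p)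

  ⊑-⇒ₗ-⊗ : ∀ a b → a ⊑ b ⇒ₗ (a ⊗ b)
  ⊑-⇒ₗ-⊗ a b = Equivalence.from resₗ ⊑-refl

  ⊑-⇒ᵣ-⊗ : ∀ a b → b ⊑ a ⇒ᵣ (a ⊗ b)
  ⊑-⇒ᵣ-⊗ a b = Equivalence.from resᵣ ⊑-refl

  !-⊓-𝟙 : ∀ a → ! (a ⊓ 𝟙) ≡ ! a
  !-⊓-𝟙 a = begin
    ! (a ⊓ 𝟙)  ≡⟨ s4 a 𝟙 ⟩
    ! a ⊗ ! 𝟙  ≡⟨ cong (! a ⊗_) s3 ⟩
    ! a ⊗ 𝟙    ≡⟨ ⊗-identityʳ (! a) ⟩
    ! a        ∎
    where open ≡-Reasoning

  !-⊑-𝟙 : ∀ a → ! a ⊑ 𝟙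
  !-⊑-𝟙 a = ⊑-trans (≡⇒⊑ (sym (!-⊓-𝟙 a))) (⊑-trans (s1 (a ⊓ 𝟙)) (⊓-lowerʳ a 𝟙))

  !-mono : ∀ {a b} → a ⊑ b → ! a ⊑ ! b
  !-mono {a} {b} p = ⊑-trans (≡⇒⊑ (trans (cong ! (sym a⊓b≡a)) (s4 a b)))
    (⊑-trans (⊗-mono (!-⊑-𝟙 a) ⊑-refl) (≡⇒⊑ (⊗-identityˡ (! b))))
    where
    a⊓b≡a : a ⊓ b ≡ a
    a⊓b≡a = ⊑-antisym (⊓-lowerˡ a b) (⊓-greatest ⊑-refl p)

  ¿-mono : ∀ {a b} → a ⊑ b → ¿ a ⊑ ¿ b
  ¿-mono {a} {b} p = ⊑-trans (≡⇒⊑ (sym (⊗-identityˡ (¿ a)))) (Equivalence.to resₗ 𝟙⊑¿a⇒¿b)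
    where
    𝟙⊑¿a⇒¿b : 𝟙 ⊑ ¿ a ⇒ₗ ¿ b
    𝟙⊑¿a⇒¿b = ⊑-trans (≡⇒⊑ (sym s3)) (⊑-trans (!-mono (⊑⇒𝟙⊑⇒ₗ p)) (c1ₗ a b))

  !-⊗-¿ : ∀ a b → ! a ⊗ ¿ b ⊑ ¿ (a ⊗ b)
  !-⊗-¿ a b = Equivalence.to resₗ (⊑-trans (!-mono (⊑-⇒ₗ-⊗ a b)) (c1ₗ b (a ⊗ b)))

  ¿-⊗-! : ∀ a b → ¿ a ⊗ ! b ⊑ ¿ (a ⊗ b)
  ¿-⊗-! a b = Equivalence.to resᵣ (⊑-trans (!-mono (⊑-⇒ᵣ-⊗ a b)) (c1ᵣ a (a ⊗ b)))

lemma2 : ∀ {c ℓ} (M : ModalFLAlgebra c ℓ) → let open ModalFLAlgebra M in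
    (∀ {a b} → a ⊑ b → ¿ a ⊑ ¿ b)
    × (∀ a b → ! a ⊗ ¿ b ⊑ ¿ (a ⊗ b))
    × (∀ a b → ¿ a ⊗ ! b ⊑ ¿ (a ⊗ b))
lemma2 M = ¿-mono , !-⊗-¿ , ¿-⊗-!
  where open ModalFLAlgebraProperties M
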